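{- Let $G=(V,E)$ be a graph and let $F\subseteq\binom{V}{2}$ be a minimal set of vertex pairs (no proper subset $F'\subsetneq F$ has the property that $(V,E\,\triangle\,F')$ is a cograph) such that $G'=(V,E\,\triangle\,F)$ is a cograph. Then for every $\{x,y\}\in F\setminus E$, the vertices $x$ and $y$ lie in the same connected component of $G$.
   Context: A cograph is a graph containing no induced path on four vertices ($P_4$-free). $\triangle$ denotes symmetric difference, so $E\,\triangle\,F$ inserts the pairs of $F\setminus E$ as edges and deletes the edges of $F\cap E$. -}

module Defs where

open import Data.Nat using (ℕ)
open import Data.Fin using (Fin)
open import Data.Bool using (Bool; true; false; _xor_)
open import Data.Product using (Σ; _×_; ∃)
open import Relation.Binary.PropositionalEquality using (_≡_; _≢_)
open import Relation.Nullary using (¬_)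

Rel₂ : ℕ → Set
Rel₂ n = Fin n → Fin n → Bool

-- A set of unordered pairs of distinct vertices, i.e. a subset of (V choose 2),
-- encoded as a symmetric irreflexive Boolean relation.
-- A (finite simple) graph on V = Fin n is given by such a set of edges.
IsPairSet : ∀ {n} → Rel₂ n → Set
IsPairSet {n} R = (∀ (x y : Fin n) → R x y ≡ R y x) × (∀ (x : Fin n) → R x x ≡ false)

_△_ : ∀ {n} → Rel₂ n → Rel₂ n → Rel₂ n
(E △ F) x y = E x y xor F x y

InducedP4 : ∀ {n} → Rel₂ n → Fin n → Fin n → Fin n → Fin n → Set
InducedP4 E a b c d =
  (a ≢ b × a ≢ c × a ≢ d × b ≢ c × b ≢ d × c ≢ d) ×
  (E a b ≡ true × E b c ≡ true × E c d ≡ true) ×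
  (E a c ≡ false × E b d ≡ false × E a d ≡ false)

IsCograph : ∀ {n} → Rel₂ n → Set
IsCograph {n} E = ∀ (a b c d : Fin n) → ¬ InducedP4 E a b c d

_⊆ᴾ_ : ∀ {n} → Rel₂ n → Rel₂ n → Set
_⊆ᴾ_ {n} A B = ∀ (x y : Fin n) → A x y ≡ true → B x y ≡ true

_⊂ᴾ_ : ∀ {n} → Rel₂ n → Rel₂ n → Set
_⊂ᴾ_ {n} A B = A ⊆ᴾ B × Σ (Fin n) (λ x → Σ (Fin n) (λ y → B x y ≡ true × A x y ≡ false))

MinimalCographEdit : ∀ {n} → Rel₂ n → Rel₂ n → Set
MinimalCographEdit {n} E F =
  IsPairSet F × IsCograph (E △ F) ×
  (∀ (F' : Rel₂ n) → IsPairSet F' → F' ⊂ᴾ F → ¬ IsCograph (E △ F'))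

data Connected {n} (E : Rel₂ n) : Fin n → Fin n → Set where
  here : ∀ {x} → Connected E x x
  step : ∀ {x y z} → E x y ≡ true → Connected E y z → Connected E x z

-- Let F' be F restricted to the pairs lying in a common component of G. Every edge of
-- E △ F' joins two vertices of one component, so all six pairs among the vertices of an
-- induced P4 of E △ F' lie in one component; there E △ F' and E △ F agree, so the P4 is
-- also induced in the cograph E △ F. Hence E △ F' is a cograph, and minimality of F
-- forces F' = F: no pair of F joins two components.
module Submission where

open import Defs
open import Data.Nat using (ℕ)
open import Data.Fin using (Fin; _≟_)
open import Data.Bool using (true; false; _∧_; _xor_) renaming (_≟_ to _≟ᵇ_)
open import Data.Bool.Properties using (∧-identityʳ; ∧-zeroʳ; xor-identityʳ)
open import Data.List using (List; []; _∷_; allFin)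
open import Data.List.Relation.Unary.Any using (here; there)
open import Data.List.Membership.Propositional using (_∈_)
open import Data.List.Membership.Propositional.Properties using (∈-allFin)
open import Data.Product using (_,_; _×_)
open import Data.Sum using (_⊎_; inj₁; inj₂)
open import Data.Empty using (⊥-elim)
open import Relation.Nullary using (Dec; yes; no; ¬_)
open import Relation.Nullary.Decidable using (⌊_⌋; decidable-stable; map′; _⊎-dec_; _×-dec_)
open import Relation.Binary.PropositionalEquality using (_≡_; refl; sym; trans; cong; cong₂)

_∩ᴾ_ : ∀ {n} → Rel₂ n → Rel₂ n → Rel₂ n
(F ∩ᴾ S) x y = F x y ∧ S x y

Transitiveᴾ : ∀ {n} → Rel₂ n → Set
Transitiveᴾ {n} S = ∀ {x y z : Fin n} → S x y ≡ true → S y z ≡ true → S x z ≡ true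

module _ {n : ℕ} (E F S : Rel₂ n) where

  ∩ᴾ-⊆ˡ : (F ∩ᴾ S) ⊆ᴾ F
  ∩ᴾ-⊆ˡ x y p with F x y
  ... | true = refl

  ∩ᴾ-IsPairSet : IsPairSet F → (∀ x y → S x y ≡ S y x) → IsPairSet (F ∩ᴾ S)
  ∩ᴾ-IsPairSet (F-sym , F-irrefl) S-sym =
    (λ x y → cong₂ _∧_ (F-sym x y) (S-sym x y)) ,
    (λ x → cong (_∧ S x x) (F-irrefl x))

  ∩ᴾ-⊂ : ∀ x y → F x y ≡ true → S x y ≡ false → (F ∩ᴾ S) ⊂ᴾ F
  ∩ᴾ-⊂ x y Fxy Sxy = ∩ᴾ-⊆ˡ , x , y , Fxy , cong₂ _∧_ Fxy Sxy

  △-∩ᴾ-agrees : ∀ {x y} → S x y ≡ true → (E △ (F ∩ᴾ S)) x y ≡ (E △ F) x y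
  △-∩ᴾ-agrees {x} {y} Sxy =
    cong (E x y xor_) (trans (cong (F x y ∧_) Sxy) (∧-identityʳ (F x y)))

  △-∩ᴾ-⊆ : E ⊆ᴾ S → (E △ (F ∩ᴾ S)) ⊆ᴾ S
  △-∩ᴾ-⊆ E⊆S x y p with S x y in Sxy
  ... | true = refl
  ... | false rewrite ∧-zeroʳ (F x y) | xor-identityʳ (E x y) =
    trans (sym Sxy) (E⊆S x y p)

  △-∩ᴾ-IsCograph : E ⊆ᴾ S → Transitiveᴾ S →
                   IsCograph (E △ F) → IsCograph (E △ (F ∩ᴾ S))
  △-∩ᴾ-IsCograph E⊆S S-trans cograph a b c d
    (distinct , (ab , bc , cd) , (ac , bd , ad)) =
    cograph a b c d
      (distinct , (back Sab ab , back Sbc bc , back Scd cd) ,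
                  (back Sac ac , back Sbd bd , back Sad ad))
    where
    back : ∀ {x y v} → S x y ≡ true → (E △ (F ∩ᴾ S)) x y ≡ v → (E △ F) x y ≡ v
    back Sxy = trans (sym (△-∩ᴾ-agrees Sxy))
    Sab = △-∩ᴾ-⊆ E⊆S a b ab
    Sbc = △-∩ᴾ-⊆ E⊆S b c bc
    Scd = △-∩ᴾ-⊆ E⊆S c d cd
    Sac = S-trans Sab Sbc
    Sbd = S-trans Sbc Scd
    Sad = S-trans Sac Scd

module Connectivity {n : ℕ} (E : Rel₂ n) where

  connected-trans : ∀ {x y z} → Connected E x y → Connected E y z → Connected E x z
  connected-trans here q = q
  connected-trans (step e p) q = step e (connected-trans p q)

  connected-sym : (∀ x y → E x y ≡ E y x) → ∀ {x y} → Connected E x y → Connected E y x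
  connected-sym E-sym here = here
  connected-sym E-sym (step {x} {y} e p) =
    connected-trans (connected-sym E-sym p) (step (trans (E-sym y x) e) here)

  data WalkVia (L : List (Fin n)) : Fin n → Fin n → Set where
    stay : ∀ {x} → WalkVia L x x
    edge : ∀ {x y} → E x y ≡ true → WalkVia L x y
    via  : ∀ {x z y} → E x z ≡ true → z ∈ L → WalkVia L z y → WalkVia L x y

  walkVia-weaken : ∀ {v L x y} → WalkVia L x y → WalkVia (v ∷ L) x y
  walkVia-weaken stay = stay
  walkVia-weaken (edge e) = edge e
  walkVia-weaken (via e m w) = via e (there m) (walkVia-weaken w)

  walkVia-concat : ∀ {L x v y} → WalkVia L x v → v ∈ L → WalkVia L v y → WalkVia L x y
  walkVia-concat stay _ w = w
  walkVia-concat (edge e) m w = via e m w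
  walkVia-concat (via e m' w₁) m w = via e m' (walkVia-concat w₁ m w)

  walkVia-[]⁻ : ∀ {x y} → WalkVia [] x y → x ≡ y ⊎ E x y ≡ true
  walkVia-[]⁻ stay = inj₁ refl
  walkVia-[]⁻ (edge e) = inj₂ e

  walkVia-[]⁺ : ∀ {x y} → x ≡ y ⊎ E x y ≡ true → WalkVia [] x y
  walkVia-[]⁺ (inj₁ refl) = stay
  walkVia-[]⁺ (inj₂ e) = edge e

  -- The Floyd–Warshall step: a walk allowed to pass through v passes through it or not.
  walkVia-∷⁻ : ∀ {v L x y} → WalkVia (v ∷ L) x y →
               WalkVia L x y ⊎ (WalkVia L x v × WalkVia L v y)
  walkVia-∷⁻ stay = inj₁ stay
  walkVia-∷⁻ (edge e) = inj₁ (edge e)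
  walkVia-∷⁻ (via e (here refl) w) with walkVia-∷⁻ w
  ... | inj₁ w′ = inj₂ (edge e , w′)
  ... | inj₂ (_ , w′) = inj₂ (edge e , w′)
  walkVia-∷⁻ (via e (there m) w) with walkVia-∷⁻ w
  ... | inj₁ w′ = inj₁ (via e m w′)
  ... | inj₂ (w₁ , w₂) = inj₂ (via e m w₁ , w₂)

  walkVia-∷⁺ : ∀ {v L x y} → WalkVia L x y ⊎ (WalkVia L x v × WalkVia L v y) →
               WalkVia (v ∷ L) x y
  walkVia-∷⁺ (inj₁ w) = walkVia-weaken w
  walkVia-∷⁺ (inj₂ (w₁ , w₂)) =
    walkVia-concat (walkVia-weaken w₁) (here refl) (walkVia-weaken w₂)

  walkVia? : ∀ L x y → Dec (WalkVia L x y)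
  walkVia? [] x y = map′ walkVia-[]⁺ walkVia-[]⁻ (x ≟ y ⊎-dec E x y ≟ᵇ true)
  walkVia? (v ∷ L) x y =
    map′ walkVia-∷⁺ walkVia-∷⁻ (walkVia? L x y ⊎-dec (walkVia? L x v ×-dec walkVia? L v y))

  walkVia⇒connected : ∀ {L x y} → WalkVia L x y → Connected E x y
  walkVia⇒connected stay = here
  walkVia⇒connected (edge e) = step e here
  walkVia⇒connected (via e _ w) = step e (walkVia⇒connected w)

  connected⇒walkVia : ∀ {x y} → Connected E x y → WalkVia (allFin n) x y
  connected⇒walkVia here = stay
  connected⇒walkVia (step e p) = via e (∈-allFin _) (connected⇒walkVia p)

  connected? : ∀ x y → Dec (Connected E x y)
  connected? x y = map′ walkVia⇒connected connected⇒walkVia (walkVia? (allFin n) x y)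

  sameComponent : Rel₂ n
  sameComponent x y = ⌊ connected? x y ⌋

  sameComponent-sound : ∀ {x y} → sameComponent x y ≡ true → Connected E x y
  sameComponent-sound {x} {y} p with connected? x y
  ... | yes c = c

  sameComponent-complete : ∀ {x y} → Connected E x y → sameComponent x y ≡ true
  sameComponent-complete {x} {y} c with connected? x y
  ... | yes _ = refl
  ... | no ¬c = ⊥-elim (¬c c)

  sameComponent-false : ∀ {x y} → ¬ Connected E x y → sameComponent x y ≡ false
  sameComponent-false {x} {y} ¬c with connected? x y
  ... | yes c = ⊥-elim (¬c c)
  ... | no _ = refl

  edge⊆sameComponent : E ⊆ᴾ sameComponent
  edge⊆sameComponent x y e = sameComponent-complete (step e here)

  sameComponent-trans : Transitiveᴾ sameComponent
  sameComponent-trans p q =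
    sameComponent-complete (connected-trans (sameComponent-sound p) (sameComponent-sound q))

  sameComponent-sym : (∀ x y → E x y ≡ E y x) → ∀ x y → sameComponent x y ≡ sameComponent y x
  sameComponent-sym E-sym x y with connected? x y | connected? y x
  ... | yes _ | yes _ = refl
  ... | no _ | no _ = refl
  ... | yes c | no ¬c = ⊥-elim (¬c (connected-sym E-sym c))
  ... | no ¬c | yes c = ⊥-elim (¬c (connected-sym E-sym c))

lemma9 : ∀ (n : ℕ) (E F : Rel₂ n) → IsPairSet E → MinimalCographEdit E F →
    ∀ (x y : Fin n) → F x y ≡ true → E x y ≡ false → Connected E x y
lemma9 n E F (E-sym , _) (F-pairs , cograph , minimal) x y Fxy _ =
  decidable-stable (connected? x y) λ ¬c →
    minimal (F ∩ᴾ sameComponent)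
      (∩ᴾ-IsPairSet E F sameComponent F-pairs (sameComponent-sym E-sym))
      (∩ᴾ-⊂ E F sameComponent x y Fxy (sameComponent-false ¬c))
      (△-∩ᴾ-IsCograph E F sameComponent edge⊆sameComponent sameComponent-trans cograph)
  where open Connectivity E
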